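{- Let $n \in \mathbb{N}$, $n\ge1$. Every simple two-dimensional lattice path of length $n$ has reduction degree $D_n$ satisfying \[ [\![ n > 1 ]\!] \leq D_{n} \leq \lfloor \log_{2}n\rfloor, \] and these bounds are sharp, i.e. for each $n$ both bounds are attained by some path of length $n$.
   Context: A simple two-dimensional lattice path of length $n\ge1$ is a word of length $n$ over the steps $\{\uparrow,\rightarrow,\downarrow,\leftarrow\}$; $\rightarrow,\leftarrow$ are horizontal and $\uparrow,\downarrow$ vertical. The reduction $\Phi_L$ is defined on paths of length $\ge2$ as follows: (1) if the path starts with a vertical step, rotate the whole path by $90^\circ$ clockwise; (2) if the resulting path ends with a horizontal step, rotate that last step by $90^\circ$ clockwise. The path now decomposes uniquely into segments, each a nonempty run of horizontal steps followed by a nonempty run of vertical steps. (3) Replace each segment by one diagonal step: $\nearrow$ if it starts with $\rightarrow$ and its first vertical step is $\uparrow$; $\searrow$ if $\rightarrow$ and $\downarrow$; $\swarrow$ if $\leftarrow$ and $\downarrow$; $\nwarrow$ if $\leftarrow$ and $\uparrow$. (4) Rotate by $45^\circ$ clockwise: $\nearrow\mapsto\rightarrow$, $\searrow\mapsto\downarrow$, $\swarrow\mapsto\leftarrow$, $\nwarrow\mapsto\uparrow$. The result is $\Phi_L(\ell)$; $\Phi_L$ is undefined on single steps. The reduction degree of $\ell$ is the unique $m\ge0$ with $\Phi_L^m(\ell)$ a single step; $D_n$ denotes the reduction degree of a path of length $n$. $[\![P]\!]$ is $1$ if $P$ holds and $0$ otherwise. -}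

module Defs where

open import Data.Nat using (ℕ; zero; suc; _<ᵇ_)
open import Data.Bool using (Bool; true; false; if_then_else_)
open import Data.List using (List; []; _∷_; length; map)
open import Relation.Binary.PropositionalEquality using (_≡_)

data Step : Set where
  up right down left : Step

Path : Set
Path = List Step

horizontal : Step → Bool
horizontal up    = false
horizontal right = true
horizontal down  = false
horizontal left  = true

rotCW : Step → Step
rotCW up    = right
rotCW right = down
rotCW down  = left
rotCW left  = up

norm1 : Path → Path
norm1 []       = []
norm1 (s ∷ xs) = if horizontal s then s ∷ xs else map rotCW (s ∷ xs)

norm2 : Path → Path
norm2 []           = []
norm2 (x ∷ [])     = (if horizontal x then rotCW x else x) ∷ []
norm2 (x ∷ y ∷ xs) = x ∷ norm2 (y ∷ xs)

-- (3)+(4): a segment starting with horizontal step h whose first vertical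
-- step is v becomes a diagonal step, then rotated 45° clockwise:
-- ↗ ↦ →, ↘ ↦ ↓, ↙ ↦ ←, ↖ ↦ ↑.  (Other combinations cannot occur.)
combine : Step → Step → Step
combine right up   = right
combine right down = down
combine left  down = left
combine left  up   = up
combine h     v    = h

-- Segment decomposition (runs of horizontal steps followed by runs of
-- vertical steps), emitting one step per segment.
mutual
  segStart : Path → Path
  segStart []       = []
  segStart (s ∷ xs) = if horizontal s then inH s xs else segStart xs

  inH : Step → Path → Path
  inH h []       = []
  inH h (s ∷ xs) = if horizontal s then inH h xs else combine h s ∷ segStart xs

-- The reduction Φ_L (meaningful on paths of length ≥ 2).
ΦL : Path → Path
ΦL ℓ = segStart (norm2 (norm1 ℓ))

data ReductionDegree : Path → ℕ → Set where
  base : ∀ {ℓ} → length ℓ ≡ 1 → ReductionDegree ℓ zero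
  step : ∀ {ℓ m} → 2 Data.Nat.≤ length ℓ → ReductionDegree (ΦL ℓ) m →
         ReductionDegree ℓ (suc m)

⟦_⟧ : Bool → ℕ
⟦ true ⟧  = 1
⟦ false ⟧ = 0

-- Φ_L merges each segment (a horizontal run followed by a vertical run, so at
-- least two steps) into one step, hence it at least halves the length of a
-- path and never empties it; iterating gives at most ⌊log₂ n⌋ reductions.
-- Conversely, every path of length k has a Φ_L-preimage of every length
-- n ≥ 2k: split each step into its horizontal and vertical components and pad
-- the last vertical run.  Starting from a single step and preimaging with
-- k = ⌊n/2⌋ recursively realises the upper bound; preimaging a single step
-- once realises the lower bound.
module Submission where

open import Defs
open import Data.Nat using (ℕ; zero; suc; _+_; _*_; _∸_; _≤_; _<_; _<ᵇ_; z≤n; s≤s; ⌊_/2⌋; >-nonZero)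
open import Data.Nat.Properties using (≤-trans; <-≤-trans; *-comm; m<m*n; m≤n⇒m≤1+n; *-suc; +-comm; m+[n∸m]≡n; m∸n+n≡m; ⌊n/2⌋<n)
open import Data.Nat.Induction using (<-rec)
open import Data.Nat.Logarithm using (⌊log₂_⌋; ⌊log₂⌋-mono-≤; ⌊log₂⌊n/2⌋⌋≡⌊log₂n⌋∸1; ⌊log₂[2*b]⌋≡1+⌊log₂b⌋)
open import Data.Bool using (true; false)
open import Data.List using ([]; _∷_; length; map; replicate)
open import Data.List.Properties using (length-map; length-replicate)
open import Data.Product using (_×_; ∃; _,_)
open import Function using (_∘_)
open import Relation.Binary.PropositionalEquality using (_≡_; refl; sym; trans; cong; cong₂; subst; module ≡-Reasoning)
open ≡-Reasoning

length-norm1 : ∀ ℓ → length (norm1 ℓ) ≡ length ℓ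
length-norm1 []      = refl
length-norm1 (s ∷ ℓ) with horizontal s
... | true  = refl
... | false = length-map rotCW (s ∷ ℓ)

length-norm2 : ∀ ℓ → length (norm2 ℓ) ≡ length ℓ
length-norm2 []          = refl
length-norm2 (_ ∷ [])    = refl
length-norm2 (_ ∷ s ∷ ℓ) = cong suc (length-norm2 (s ∷ ℓ))

mutual
  segStart-halves : ∀ ℓ → 2 * length (segStart ℓ) ≤ length ℓ
  segStart-halves []      = z≤n
  segStart-halves (s ∷ ℓ) with horizontal s
  ... | true  = inH-halves s ℓ
  ... | false = m≤n⇒m≤1+n (segStart-halves ℓ)

  inH-halves : ∀ h ℓ → 2 * length (inH h ℓ) ≤ suc (length ℓ)
  inH-halves h []      = z≤n
  inH-halves h (s ∷ ℓ) with horizontal s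
  ... | true  = m≤n⇒m≤1+n (inH-halves h ℓ)
  ... | false rewrite *-suc 2 (length (segStart ℓ)) = s≤s (s≤s (segStart-halves ℓ))

ΦL-halves : ∀ ℓ → 2 * length (ΦL ℓ) ≤ length ℓ
ΦL-halves ℓ = subst (2 * length (ΦL ℓ) ≤_) lengths-agree (segStart-halves (norm2 (norm1 ℓ)))
  where
  lengths-agree : length (norm2 (norm1 ℓ)) ≡ length ℓ
  lengths-agree = begin
    length (norm2 (norm1 ℓ)) ≡⟨ length-norm2 (norm1 ℓ) ⟩
    length (norm1 ℓ)         ≡⟨ length-norm1 ℓ ⟩
    length ℓ                 ∎

-- After norm2 the path ends vertically, so the segment opened by its first
-- horizontal step is eventually closed and emits a step.
inH-nonempty : ∀ h g ℓ → 1 ≤ length (inH h (norm2 (g ∷ ℓ)))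
inH-nonempty h up    []      = s≤s z≤n
inH-nonempty h right []      = s≤s z≤n
inH-nonempty h down  []      = s≤s z≤n
inH-nonempty h left  []      = s≤s z≤n
inH-nonempty h up    (s ∷ ℓ) = s≤s z≤n
inH-nonempty h right (s ∷ ℓ) = inH-nonempty h s ℓ
inH-nonempty h down  (s ∷ ℓ) = s≤s z≤n
inH-nonempty h left  (s ∷ ℓ) = inH-nonempty h s ℓ

ΦL-nonempty : ∀ s t ℓ → 1 ≤ length (ΦL (s ∷ t ∷ ℓ))
ΦL-nonempty up    t ℓ = inH-nonempty right (rotCW t) (map rotCW ℓ)
ΦL-nonempty right t ℓ = inH-nonempty right t ℓ
ΦL-nonempty down  t ℓ = inH-nonempty left (rotCW t) (map rotCW ℓ)
ΦL-nonempty left  t ℓ = inH-nonempty left t ℓ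

2*k≤n⇒k<n : ∀ {k n} → 1 ≤ k → 2 * k ≤ n → k < n
2*k≤n⇒k<n {k} 1≤k 2k≤n =
  <-≤-trans (subst (k <_) (*-comm k 2) (m<m*n k 2 {{>-nonZero 1≤k}} (s≤s (s≤s z≤n)))) 2k≤n

1+⌊log₂⌋≤⌊log₂⌋ : ∀ {k n} → 1 ≤ k → 2 * k ≤ n → suc ⌊log₂ k ⌋ ≤ ⌊log₂ n ⌋
1+⌊log₂⌋≤⌊log₂⌋ {k} 1≤k 2k≤n =
  subst (_≤ _) (⌊log₂[2*b]⌋≡1+⌊log₂b⌋ k {{>-nonZero 1≤k}}) (⌊log₂⌋-mono-≤ 2k≤n)

degree-≤-⌊log₂⌋ : ∀ ℓ → 1 ≤ length ℓ → ∃ λ m → ReductionDegree ℓ m × m ≤ ⌊log₂ length ℓ ⌋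
degree-≤-⌊log₂⌋ ℓ = <-rec Bounded bounded (length ℓ) ℓ refl
  where
  Bounded : ℕ → Set
  Bounded n = ∀ ℓ → length ℓ ≡ n → 1 ≤ n → ∃ λ m → ReductionDegree ℓ m × m ≤ ⌊log₂ n ⌋

  bounded : ∀ n → (∀ {k} → k < n → Bounded k) → Bounded n
  bounded n rec (_ ∷ [])        refl _ = 0 , base refl , z≤n
  bounded n rec ℓ@(s ∷ t ∷ ℓ′) refl _ =
    let nonempty = ΦL-nonempty s t ℓ′
        m , degree , m≤log = rec (2*k≤n⇒k<n nonempty (ΦL-halves ℓ)) (ΦL ℓ) refl nonempty
    in suc m , step (s≤s (s≤s z≤n)) degree ,
       ≤-trans (s≤s m≤log) (1+⌊log₂⌋≤⌊log₂⌋ nonempty (ΦL-halves ℓ))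

iverson≤degree : ∀ {ℓ m} → ReductionDegree ℓ m → ⟦ 1 <ᵇ length ℓ ⟧ ≤ m
iverson≤degree (base length≡1) rewrite length≡1 = z≤n
iverson≤degree {ℓ} (step _ _) with 1 <ᵇ length ℓ
... | true  = s≤s z≤n
... | false = z≤n

horizontalOf verticalOf : Step → Step
horizontalOf up    = left
horizontalOf right = right
horizontalOf down  = right
horizontalOf left  = left
verticalOf up    = up
verticalOf right = up
verticalOf down  = down
verticalOf left  = down

horizontal-horizontalOf : ∀ s → horizontal (horizontalOf s) ≡ true
horizontal-horizontalOf up    = refl
horizontal-horizontalOf right = refl
horizontal-horizontalOf down  = refl
horizontal-horizontalOf left  = refl

horizontal-verticalOf : ∀ s → horizontal (verticalOf s) ≡ false
horizontal-verticalOf up    = refl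
horizontal-verticalOf right = refl
horizontal-verticalOf down  = refl
horizontal-verticalOf left  = refl

combine-horizontalOf-verticalOf : ∀ s → combine (horizontalOf s) (verticalOf s) ≡ s
combine-horizontalOf-verticalOf up    = refl
combine-horizontalOf-verticalOf right = refl
combine-horizontalOf-verticalOf down  = refl
combine-horizontalOf-verticalOf left  = refl

mutual
  unreduce : ℕ → Step → Path → Path
  unreduce pad s ℓ = horizontalOf s ∷ verticalOf s ∷ unreduce-rest pad s ℓ

  unreduce-rest : ℕ → Step → Path → Path
  unreduce-rest pad s []      = replicate pad (verticalOf s)
  unreduce-rest pad s (t ∷ ℓ) = unreduce pad t ℓ

length-unreduce : ∀ pad s ℓ → length (unreduce pad s ℓ) ≡ 2 * length (s ∷ ℓ) + pad
length-unreduce pad s []      = cong (2 +_) (length-replicate pad)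
length-unreduce pad s (t ∷ ℓ) = begin
  2 + length (unreduce pad t ℓ)  ≡⟨ cong (2 +_) (length-unreduce pad t ℓ) ⟩
  2 + (2 * length (t ∷ ℓ) + pad) ≡⟨ cong (_+ pad) (sym (*-suc 2 (length (t ∷ ℓ)))) ⟩
  2 * length (s ∷ t ∷ ℓ) + pad   ∎

norm1-horizontal : ∀ {h} ℓ → horizontal h ≡ true → norm1 (h ∷ ℓ) ≡ h ∷ ℓ
norm1-horizontal ℓ h-horizontal rewrite h-horizontal = refl

norm2-vertical-run : ∀ {v} k → horizontal v ≡ false → norm2 (replicate (suc k) v) ≡ replicate (suc k) v
norm2-vertical-run zero    v-vertical rewrite v-vertical = refl
norm2-vertical-run (suc k) v-vertical = cong (_ ∷_) (norm2-vertical-run k v-vertical)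

norm2-unreduce : ∀ pad s ℓ → norm2 (unreduce pad s ℓ) ≡ unreduce pad s ℓ
norm2-unreduce pad s []      = cong (horizontalOf s ∷_) (norm2-vertical-run pad (horizontal-verticalOf s))
norm2-unreduce pad s (t ∷ ℓ) = cong (λ ℓ′ → horizontalOf s ∷ verticalOf s ∷ ℓ′) (norm2-unreduce pad t ℓ)

segStart-segment : ∀ {h v} ℓ → horizontal h ≡ true → horizontal v ≡ false →
                   segStart (h ∷ v ∷ ℓ) ≡ combine h v ∷ segStart ℓ
segStart-segment ℓ h-horizontal v-vertical rewrite h-horizontal | v-vertical = refl

segStart-vertical-run : ∀ {v} k → horizontal v ≡ false → segStart (replicate k v) ≡ []
segStart-vertical-run zero    _          = refl
segStart-vertical-run (suc k) v-vertical rewrite v-vertical = segStart-vertical-run k v-vertical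

segStart-unreduce : ∀ pad s ℓ → segStart (unreduce pad s ℓ) ≡ s ∷ ℓ
segStart-unreduce pad s ℓ = begin
  segStart (unreduce pad s ℓ)
    ≡⟨ segStart-segment (unreduce-rest pad s ℓ) (horizontal-horizontalOf s) (horizontal-verticalOf s) ⟩
  combine (horizontalOf s) (verticalOf s) ∷ segStart (unreduce-rest pad s ℓ)
    ≡⟨ cong₂ _∷_ (combine-horizontalOf-verticalOf s) (segStart-rest ℓ) ⟩
  s ∷ ℓ ∎
  where
  segStart-rest : ∀ ℓ → segStart (unreduce-rest pad s ℓ) ≡ ℓ
  segStart-rest []      = segStart-vertical-run pad (horizontal-verticalOf s)
  segStart-rest (t ∷ ℓ) = segStart-unreduce pad t ℓ

ΦL-unreduce : ∀ pad s ℓ → ΦL (unreduce pad s ℓ) ≡ s ∷ ℓ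
ΦL-unreduce pad s ℓ = begin
  segStart (norm2 (norm1 (unreduce pad s ℓ)))
    ≡⟨ cong (segStart ∘ norm2) (norm1-horizontal _ (horizontal-horizontalOf s)) ⟩
  segStart (norm2 (unreduce pad s ℓ)) ≡⟨ cong segStart (norm2-unreduce pad s ℓ) ⟩
  segStart (unreduce pad s ℓ)         ≡⟨ segStart-unreduce pad s ℓ ⟩
  s ∷ ℓ                               ∎

ΦL-preimage : ∀ s ℓ {n} → 2 * length (s ∷ ℓ) ≤ n → ∃ λ ℓ′ → length ℓ′ ≡ n × ΦL ℓ′ ≡ s ∷ ℓ
ΦL-preimage s ℓ {n} 2k≤n =
  unreduce (n ∸ 2 * length (s ∷ ℓ)) s ℓ ,
  trans (length-unreduce _ s ℓ) (m+[n∸m]≡n 2k≤n) ,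
  ΦL-unreduce _ s ℓ

2*⌊n/2⌋≤n : ∀ n → 2 * ⌊ n /2⌋ ≤ n
2*⌊n/2⌋≤n zero          = z≤n
2*⌊n/2⌋≤n (suc zero)    = z≤n
2*⌊n/2⌋≤n (suc (suc n)) rewrite *-suc 2 ⌊ n /2⌋ = s≤s (s≤s (2*⌊n/2⌋≤n n))

⌊log₂n⌋≡1+⌊log₂⌊n/2⌋⌋ : ∀ {n} → 2 ≤ n → ⌊log₂ n ⌋ ≡ suc ⌊log₂ ⌊ n /2⌋ ⌋
⌊log₂n⌋≡1+⌊log₂⌊n/2⌋⌋ {n} 2≤n = begin
  ⌊log₂ n ⌋           ≡⟨ sym (m∸n+n≡m (⌊log₂⌋-mono-≤ 2≤n)) ⟩
  ⌊log₂ n ⌋ ∸ 1 + 1   ≡⟨ +-comm _ 1 ⟩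
  suc (⌊log₂ n ⌋ ∸ 1) ≡⟨ cong suc (sym (⌊log₂⌊n/2⌋⌋≡⌊log₂n⌋∸1 n)) ⟩
  suc ⌊log₂ ⌊ n /2⌋ ⌋ ∎

degree-of-preimage : ∀ {ℓ ℓ′ m} → 2 ≤ length ℓ → ΦL ℓ ≡ ℓ′ → ReductionDegree ℓ′ m → ReductionDegree ℓ (suc m)
degree-of-preimage 2≤length refl = step 2≤length

shortest-reduction : ∀ n → 1 ≤ n → ∃ λ ℓ → length ℓ ≡ n × ReductionDegree ℓ ⟦ 1 <ᵇ n ⟧
shortest-reduction (suc zero)    _ = right ∷ [] , refl , base refl
shortest-reduction (suc (suc k)) _ =
  let ℓ , length≡n , ΦL≡ = ΦL-preimage right [] (s≤s (s≤s z≤n))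
  in ℓ , length≡n , degree-of-preimage (subst (2 ≤_) (sym length≡n) (s≤s (s≤s z≤n))) ΦL≡ (base refl)

longest-reduction : ∀ n → 1 ≤ n → ∃ λ ℓ → length ℓ ≡ n × ReductionDegree ℓ ⌊log₂ n ⌋
longest-reduction = <-rec Realised realise
  where
  Realised : ℕ → Set
  Realised n = 1 ≤ n → ∃ λ ℓ → length ℓ ≡ n × ReductionDegree ℓ ⌊log₂ n ⌋

  realise : ∀ n → (∀ {k} → k < n → Realised k) → Realised n
  realise (suc zero) _ _ = right ∷ [] , refl , base refl
  realise n@(suc (suc r)) rec _ with rec (⌊n/2⌋<n (suc r)) (s≤s z≤n)
  ... | s ∷ ℓ , length≡⌊n/2⌋ , degree =
    let ℓ′ , length≡n , ΦL≡ = ΦL-preimage s ℓ (subst (λ k → 2 * k ≤ n) (sym length≡⌊n/2⌋) (2*⌊n/2⌋≤n n))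
    in ℓ′ , length≡n ,
       subst (ReductionDegree ℓ′) (sym (⌊log₂n⌋≡1+⌊log₂⌊n/2⌋⌋ 2≤n))
             (degree-of-preimage (subst (2 ≤_) (sym length≡n) 2≤n) ΦL≡ degree)
    where
    2≤n : 2 ≤ n
    2≤n = s≤s (s≤s z≤n)

proposition3p6 : ∀ (n : ℕ) → 1 ≤ n →
    ((ℓ : Path) → length ℓ ≡ n →
        ∃ λ m → ReductionDegree ℓ m × ⟦ 1 <ᵇ n ⟧ ≤ m × m ≤ ⌊log₂ n ⌋)
    × (∃ λ (ℓ : Path) → length ℓ ≡ n × ReductionDegree ℓ ⟦ 1 <ᵇ n ⟧)
    × (∃ λ (ℓ : Path) → length ℓ ≡ n × ReductionDegree ℓ ⌊log₂ n ⌋)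
proposition3p6 n 1≤n = degree-bounds , shortest-reduction n 1≤n , longest-reduction n 1≤n
  where
  degree-bounds : (ℓ : Path) → length ℓ ≡ n →
                  ∃ λ m → ReductionDegree ℓ m × ⟦ 1 <ᵇ n ⟧ ≤ m × m ≤ ⌊log₂ n ⌋
  degree-bounds ℓ refl =
    let m , degree , m≤log = degree-≤-⌊log₂⌋ ℓ 1≤n
    in m , degree , iverson≤degree degree , m≤log
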